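{- For any graph $G$ of diameter two, $G_{SR}\cong G^*_-$.
   Context: All graphs are finite, simple and undirected; $d_G$ is the distance in $G$, $N_G[v]$ the closed neighborhood. Distinct vertices $u,v$ are true twins if $N_G[u]=N_G[v]$. A vertex $u$ is maximally distant from $v$ if $d_G(v,w)\le d_G(u,v)$ for every neighbor $w$ of $u$. Vertices $u,v$ are mutually maximally distant (MMD) if each is maximally distant from the other. The boundary $\partial(G)$ is the set of vertices maximally distant from some vertex of $G$. The strong resolving graph $G_{SR}$ has vertex set $\partial(G)$, two vertices being adjacent iff they are MMD in $G$. $G^*$ is the graph with vertex set $V(G)$ in which $u,v$ are adjacent iff $d_G(u,v)\ge 2$ or $u,v$ are true twins in $G$; $G^*_-$ is obtained from $G^*$ by removing all its isolated vertices. -}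

module Defs where

open import Data.Nat using (ℕ; zero; suc; _≤_)
open import Data.Fin using (Fin)
open import Data.Product using (Σ; ∃; _×_)
open import Data.Sum using (_⊎_)
open import Relation.Nullary using (¬_; Dec)
open import Relation.Binary.PropositionalEquality using (_≡_; _≢_)
open import Function.Bundles using (_⇔_)

record Graph (n : ℕ) : Set₁ where
  field
    Adj     : Fin n → Fin n → Set
    Adj-dec : ∀ u v → Dec (Adj u v)
    Adj-sym : ∀ {u v} → Adj u v → Adj v u
    Adj-irr : ∀ {u} → ¬ Adj u u

module _ {n : ℕ} (G : Graph n) where
  open Graph G

  data Walk : Fin n → Fin n → ℕ → Set where
    here : ∀ {u} → Walk u u zero
    step : ∀ {u w v k} → Adj u w → Walk w v k → Walk u v (suc k)

  Dist : Fin n → Fin n → ℕ → Set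
  Dist u v k = Walk u v k × (∀ m → Walk u v m → k ≤ m)

  Diameter2 : Set
  Diameter2 = (∀ u v → ∃ λ k → Dist u v k × k ≤ 2) × (∃ λ u → ∃ λ v → Dist u v 2)

  ClosedNbhd : Fin n → Fin n → Set
  ClosedNbhd u w = (w ≡ u) ⊎ Adj u w

  TrueTwins : Fin n → Fin n → Set
  TrueTwins u v = (u ≢ v) × (∀ w → ClosedNbhd u w ⇔ ClosedNbhd v w)

  MaxDistFrom : Fin n → Fin n → Set
  MaxDistFrom u v = ∀ w → Adj u w → ∀ k l → Dist v w k → Dist u v l → k ≤ l

  MMD : Fin n → Fin n → Set
  MMD u v = MaxDistFrom u v × MaxDistFrom v u

  Boundary : Fin n → Set
  Boundary u = ∃ λ v → MaxDistFrom u v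

  -- edges of the strong resolving graph G_SR (on vertex set ∂(G))
  SRAdj : Fin n → Fin n → Set
  SRAdj u v = (u ≢ v) × MMD u v

  StarAdj : Fin n → Fin n → Set
  StarAdj u v = (∀ k → Dist u v k → 2 ≤ k) ⊎ TrueTwins u v

  -- vertex set of G*_- : non-isolated vertices of G*
  StarNonIsolated : Fin n → Set
  StarNonIsolated u = ∃ λ w → StarAdj u w

record InducedIso {n : ℕ} (P Q : Fin n → Set) (A B : Fin n → Fin n → Set) : Set where
  field
    to      : Fin n → Fin n
    from    : Fin n → Fin n
    to-in   : ∀ x → P x → Q (to x)
    from-in : ∀ y → Q y → P (from y)
    from-to : ∀ x → P x → from (to x) ≡ x
    to-from : ∀ y → Q y → to (from y) ≡ y
    adj     : ∀ x y → P x → P y → (A x y ⇔ B (to x) (to y))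

-- The isomorphism is the identity on vertices. In diameter two, a pair at distance two is
-- mutually maximally distant because nothing is farther than two, and true twins are always
-- MMD; conversely an adjacent MMD pair u, v has N[u] ⊆ N[v] ⊆ N[u], i.e. they are true twins.
-- So MMD pairs are exactly the edges of G*. For the vertex sets: if u is maximally distant
-- from an adjacent v then N[u] ⊆ N[v], and either equality makes u, v twins or a vertex of
-- N[v] ∖ N[u] is at distance two from u; a vertex maximally distant from itself is isolated,
-- hence at distance two from every other vertex.
module Submission where

open import Defs
open import Data.Nat using (ℕ; zero; suc; _≤_; z≤n; s≤s)
open import Data.Nat.Properties using (≤-trans)
open import Data.Fin using (Fin)
open import Data.Fin.Properties using (_≟_; any?)
open import Data.Product using (∃; _,_; proj₁; proj₂)
open import Data.Sum using (_⊎_; inj₁; inj₂)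
open import Data.Empty using (⊥-elim)
open import Relation.Nullary using (¬_; Dec; yes; no)
open import Relation.Nullary.Decidable using (_×-dec_; _⊎-dec_; ¬?)
open import Relation.Binary.PropositionalEquality using (_≢_; refl; sym)
open import Function.Bundles using (mk⇔; Equivalence)

module _ {n : ℕ} (G : Graph n) where
  open Graph G

  dist-refl : ∀ {u} → Dist G u u 0
  dist-refl = here , λ _ _ → z≤n

  Distant : Fin n → Fin n → Set
  Distant u v = ∀ k → Dist G u v k → 2 ≤ k

  walk-length≥2 : ∀ {u v k} → u ≢ v → ¬ Adj u v → Walk G u v k → 2 ≤ k
  walk-length≥2 u≢v _   here                = ⊥-elim (u≢v refl)
  walk-length≥2 _   ¬uv (step uv here)      = ⊥-elim (¬uv uv)
  walk-length≥2 _   _   (step _ (step _ _)) = s≤s (s≤s z≤n)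

  distant : ∀ {u v} → u ≢ v → ¬ Adj u v → Distant u v
  distant u≢v ¬uv _ (w , _) = walk-length≥2 u≢v ¬uv w

  dist-adj : ∀ {u v} → Adj u v → Dist G u v 1
  dist-adj uv = step uv here , λ
    { zero here → ⊥-elim (Adj-irr uv)
    ; (suc _) _ → s≤s z≤n }

  dist-two : ∀ {u x w} → u ≢ w → ¬ Adj u w → Adj u x → Adj x w → Dist G u w 2
  dist-two u≢w ¬uw ux xw = step ux (step xw here) , λ _ → walk-length≥2 u≢w ¬uw

  distant⇒≢ : ∀ {u v} → Distant u v → u ≢ v
  distant⇒≢ far refl with far 0 dist-refl
  ... | ()

  distant⇒¬adj : ∀ {u v} → Distant u v → ¬ Adj u v
  distant⇒¬adj far uv with far 1 (dist-adj uv)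
  ... | s≤s ()

  distant-sym : ∀ {u v} → Distant u v → Distant v u
  distant-sym far = distant (λ v≡u → distant⇒≢ far (sym v≡u)) (λ vu → distant⇒¬adj far (Adj-sym vu))

  dist-≢⇒1≤ : ∀ {u v l} → u ≢ v → Dist G u v l → 1 ≤ l
  dist-≢⇒1≤ u≢v (here , _)     = ⊥-elim (u≢v refl)
  dist-≢⇒1≤ _   (step _ _ , _) = s≤s z≤n

  closedNbhd⇒dist≤1 : ∀ {v x k} → ClosedNbhd G v x → Dist G v x k → k ≤ 1
  closedNbhd⇒dist≤1 (inj₁ refl) (_ , minimal) = ≤-trans (minimal 0 here) z≤n
  closedNbhd⇒dist≤1 (inj₂ vx)   (_ , minimal) = minimal 1 (step vx here)

  closedNbhd? : ∀ u w → Dec (ClosedNbhd G u w)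
  closedNbhd? u w = (w ≟ u) ⊎-dec Adj-dec u w

  _⊆N_ : Fin n → Fin n → Set
  u ⊆N v = ∀ w → ClosedNbhd G u w → ClosedNbhd G v w

  ⊆N-antisym : ∀ {u v} → u ≢ v → u ⊆N v → v ⊆N u → TrueTwins G u v
  ⊆N-antisym u≢v u⊆v v⊆u = u≢v , λ w → mk⇔ (u⊆v w) (v⊆u w)

  trueTwins-sym : ∀ {u v} → TrueTwins G u v → TrueTwins G v u
  trueTwins-sym (u≢v , N≡) =
    (λ v≡u → u≢v (sym v≡u)) , λ w → mk⇔ (Equivalence.from (N≡ w)) (Equivalence.to (N≡ w))

  trueTwins⇒maxDist : ∀ {u v} → TrueTwins G u v → MaxDistFrom G u v
  trueTwins⇒maxDist (u≢v , N≡) x ux _ _ dvx duv =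
    ≤-trans (closedNbhd⇒dist≤1 (Equivalence.to (N≡ x) (inj₂ ux)) dvx) (dist-≢⇒1≤ u≢v duv)

  starAdj-sym : ∀ {u v} → StarAdj G u v → StarAdj G v u
  starAdj-sym (inj₁ far)   = inj₁ (distant-sym far)
  starAdj-sym (inj₂ twins) = inj₂ (trueTwins-sym twins)

  starAdj⇒≢ : ∀ {u v} → StarAdj G u v → u ≢ v
  starAdj⇒≢ (inj₁ far)   = distant⇒≢ far
  starAdj⇒≢ (inj₂ twins) = proj₁ twins

  -- A neighbour w of u outside N[v] would be at distance two from v, via u.
  maxDist-adj⇒⊆N : ∀ {u v} → Adj u v → MaxDistFrom G u v → u ⊆N v
  maxDist-adj⇒⊆N uv _ w (inj₁ refl) = inj₂ (Adj-sym uv)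
  maxDist-adj⇒⊆N {v = v} uv max w (inj₂ uw) with w ≟ v | Adj-dec v w
  ... | yes w≡v | _      = inj₁ w≡v
  ... | no _    | yes vw = inj₂ vw
  ... | no w≢v  | no ¬vw with max w uw 2 1 (dist-two (λ v≡w → w≢v (sym v≡w)) ¬vw (Adj-sym uv) uw) (dist-adj uv)
  ...   | s≤s ()

  mmd-adj⇒trueTwins : ∀ {u v} → Adj u v → MMD G u v → TrueTwins G u v
  mmd-adj⇒trueTwins uv (u-max , v-max) =
    ⊆N-antisym (λ { refl → Adj-irr uv }) (maxDist-adj⇒⊆N uv u-max) (maxDist-adj⇒⊆N (Adj-sym uv) v-max)

  maxDist-self⇒isolated : ∀ {u w} → MaxDistFrom G u u → ¬ Adj u w
  maxDist-self⇒isolated max uw with max _ uw 1 0 (dist-adj uw) dist-refl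
  ... | ()

  ⊆N-or-distant : ∀ u v → v ⊆N u ⊎ ∃ (Distant u)
  ⊆N-or-distant u v with any? (λ w → closedNbhd? v w ×-dec ¬? (closedNbhd? u w))
  ... | yes (w , _ , w∉N[u]) =
    inj₂ (w , distant (λ u≡w → w∉N[u] (inj₁ (sym u≡w))) (λ uw → w∉N[u] (inj₂ uw)))
  ... | no none = inj₁ v⊆u
    where
    v⊆u : v ⊆N u
    v⊆u w w∈N[v] with closedNbhd? u w
    ... | yes w∈N[u] = w∈N[u]
    ... | no w∉N[u]  = ⊥-elim (none (w , w∈N[v] , w∉N[u]))

module _ {n : ℕ} (G : Graph n) (diam : Diameter2 G) where
  open Graph G

  dist≤2 : ∀ {u v k} → Dist G u v k → k ≤ 2
  dist≤2 {u} {v} (_ , minimal) with proj₁ diam u v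
  ... | k , (walk , _) , k≤2 = ≤-trans (minimal k walk) k≤2

  another-vertex : ∀ u → ∃ λ x → u ≢ x
  another-vertex u with proj₂ diam
  ... | p , q , dpq with u ≟ p
  ...   | no u≢p    = p , u≢p
  ...   | yes refl  = q , distant⇒≢ G (λ k d → proj₂ dpq k (proj₁ d))

  distant⇒maxDist : ∀ {u v} → Distant G u v → MaxDistFrom G u v
  distant⇒maxDist far _ _ _ l dvw duv = ≤-trans (dist≤2 dvw) (far l duv)

  starAdj⇒maxDist : ∀ {u v} → StarAdj G u v → MaxDistFrom G u v
  starAdj⇒maxDist (inj₁ far)   = distant⇒maxDist far
  starAdj⇒maxDist (inj₂ twins) = trueTwins⇒maxDist G twins

  starAdj⇒srAdj : ∀ {u v} → StarAdj G u v → SRAdj G u v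
  starAdj⇒srAdj uv = starAdj⇒≢ G uv , starAdj⇒maxDist uv , starAdj⇒maxDist (starAdj-sym G uv)

  srAdj⇒starAdj : ∀ {u v} → SRAdj G u v → StarAdj G u v
  srAdj⇒starAdj {u} {v} (u≢v , mmd) with Adj-dec u v
  ... | no ¬uv = inj₁ (distant G u≢v ¬uv)
  ... | yes uv = inj₂ (mmd-adj⇒trueTwins G uv mmd)

  boundary⇒starNonIsolated : ∀ {u} → Boundary G u → StarNonIsolated G u
  boundary⇒starNonIsolated {u} (v , max) with u ≟ v
  ... | yes refl = let (x , u≢x) = another-vertex u in
                   x , inj₁ (distant G u≢x (maxDist-self⇒isolated G max))
  ... | no u≢v with Adj-dec u v
  ...   | no ¬uv = v , inj₁ (distant G u≢v ¬uv)
  ...   | yes uv with ⊆N-or-distant G u v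
  ...     | inj₁ v⊆u = v , inj₂ (⊆N-antisym G u≢v (maxDist-adj⇒⊆N G uv max) v⊆u)
  ...     | inj₂ (x , far) = x , inj₁ far

  starNonIsolated⇒boundary : ∀ {u} → StarNonIsolated G u → Boundary G u
  starNonIsolated⇒boundary (v , uv) = v , starAdj⇒maxDist uv

proposition14 : (n : ℕ) (G : Graph n) → Diameter2 G →
    InducedIso (Boundary G) (StarNonIsolated G) (SRAdj G) (StarAdj G)
proposition14 n G diam = record
  { to      = λ u → u
  ; from    = λ u → u
  ; to-in   = λ _ → boundary⇒starNonIsolated G diam
  ; from-in = λ _ → starNonIsolated⇒boundary G diam
  ; from-to = λ _ _ → refl
  ; to-from = λ _ _ → refl
  ; adj     = λ _ _ _ _ → mk⇔ (srAdj⇒starAdj G diam) (starAdj⇒srAdj G diam)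
  }
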